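{- Let $n\ge4$. The wheel $W_n$ is not strong cop-win but is strong $2$-cop-win. Moreover, $\lim_{m\to\infty}\operatorname{capt}_2(W_n,m)=n-3$.
   Context: All graphs are reflexive. The game of $k$ cops and $m$ robbers: in round $0$ the cops choose starting vertices, then the robbers choose starting vertices (players may share vertices). In each round $i\ge1$ every cop moves to an adjacent vertex or stays, then every robber moves to an adjacent vertex or stays. Whenever a cop occupies the same vertex as some robbers, those robbers are captured and leave the game. For a $k$-cop-win graph $G$, $\operatorname{capt}_k(G,m)$ is the smallest $t$ such that the $k$ cops have a strategy guaranteeing all $m$ robbers are captured by round $t$ regardless of the robbers' play; $\operatorname{capt}=\operatorname{capt}_1$. $G$ is strong $k$-cop-win if $\lim_{m\to\infty}\operatorname{capt}_k(G,m)$ exists (is finite); strong cop-win means strong $1$-cop-win. The wheel $W_n$ ($n\ge4$) is the cycle $C_{n-1}$ together with a vertex adjacent to all its vertices. -}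

module Defs where

open import Data.Nat using (ℕ; zero; suc; _≤_; _∸_)
open import Data.Fin using (Fin; toℕ)
open import Data.Fin.Properties using (_≟_)
open import Data.Maybe using (Maybe; just; nothing)
open import Data.Product using (Σ; ∃; _×_; _,_)
open import Data.Sum using (_⊎_)
open import Relation.Nullary using (¬_; yes; no)
open import Relation.Nullary.Decidable using (Dec)
open import Data.Fin.Properties using (any?)
open import Relation.Binary.PropositionalEquality using (_≡_; _≢_)

-- A (finite) graph: vertices Fin N, edge relation E. Graphs are reflexive:
-- a player may always stay put (see Move).
record Graph : Set₁ where
  field
    N : ℕ
    E : Fin N → Fin N → Set

open Graph public

Move : (G : Graph) → Fin (N G) → Fin (N G) → Set
Move G u v = u ≡ v ⊎ E G u v

-- Positions: k cops, m robbers; a robber is `nothing` once captured.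
Cops : Graph → ℕ → Set
Cops G k = Fin k → Fin (N G)

Robbers : Graph → ℕ → Set
Robbers G m = Fin m → Maybe (Fin (N G))

capture : (G : Graph) {k m : ℕ} → Cops G k → Robbers G m → Robbers G m
capture G {k} c r j with r j
... | nothing = nothing
... | just v with any? (λ i → c i ≟ v)
...   | yes _ = nothing
...   | no _ = just v

AllCaptured : (G : Graph) {m : ℕ} → Robbers G m → Set
AllCaptured G r = ∀ j → r j ≡ nothing

CopsMove : (G : Graph) {k : ℕ} → Cops G k → Cops G k → Set
CopsMove G c c' = ∀ i → Move G (c i) (c' i)

data RobStep (G : Graph) : Maybe (Fin (N G)) → Maybe (Fin (N G)) → Set where
  stays-captured : RobStep G nothing nothing
  step : ∀ {u v} → Move G u v → RobStep G (just u) (just v)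

RobbersMove : (G : Graph) {m : ℕ} → Robbers G m → Robbers G m → Set
RobbersMove G r r' = ∀ j → RobStep G (r j) (r' j)

-- Round: cops move, capture, robbers move,
-- capture.
CopsWinIn : (G : Graph) {k m : ℕ} → ℕ → Cops G k → Robbers G m → Set
CopsWinIn G zero c r = AllCaptured G r
CopsWinIn G {k} {m} (suc t) c r =
  Σ (Cops G k) λ c' → CopsMove G c c' ×
    (∀ (r' : Robbers G m) → RobbersMove G (capture G c' r) r' →
       CopsWinIn G t c' (capture G c' r'))

-- k cops can guarantee capture of all m robbers by round t
-- (round 0: cops place, then robbers place).
CaptWithin : (G : Graph) (k m t : ℕ) → Set
CaptWithin G k m t =
  Σ (Cops G k) λ c₀ → ∀ (r₀ : Fin m → Fin (N G)) →
    CopsWinIn G t c₀ (capture G c₀ (λ j → just (r₀ j)))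

IsCapt : (G : Graph) (k m t : ℕ) → Set
IsCapt G k m t = CaptWithin G k m t × (∀ t' → CaptWithin G k m t' → t ≤ t')

-- lim_{m→∞} capt_k(G,m) = L   (a ℕ-valued sequence converges iff it is
-- eventually constant)
CaptLimit : (G : Graph) (k L : ℕ) → Set
CaptLimit G k L = Σ ℕ λ M → ∀ m → M ≤ m → IsCapt G k m L

StrongKCopWin : Graph → ℕ → Set
StrongKCopWin G k = Σ ℕ λ L → CaptLimit G k L

-- Wheel W_n: vertex 0 is the hub, vertices 1..n-1 form the cycle C_{n-1}
-- (i ~ i+1, and 1 ~ n-1).
WheelAdj : ℕ → ℕ → ℕ → Set
WheelAdj n a b =
  (a ≡ 0 × b ≢ 0) ⊎ (b ≡ 0 × a ≢ 0) ⊎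
  (1 ≤ a × suc a ≡ b) ⊎ (1 ≤ b × suc b ≡ a) ⊎
  (a ≡ 1 × b ≡ n ∸ 1) ⊎ (b ≡ 1 × a ≡ n ∸ 1)

wheel : ℕ → Graph
wheel n = record { N = n ; E = λ u v → WheelAdj n (toℕ u) (toℕ v) }

-- With at least V ^ (t + 1) robbers on a graph with V vertices, the robbers split into blocks by
-- the base-V digits of their indices; in every round each block splits into V sub-blocks, one for each
-- vertex, and a sub-block runs to its vertex whenever that is a cop-free neighbour.  The robbers thus
-- occupy the whole territory reachable while avoiding the cops, and the cops need more than t rounds
-- as long as that territory can survive t rounds.
-- On W_n one cop leaves every vertex but its own in the territory, as every vertex has two further
-- neighbours; hence no round bound holds for all numbers of robbers.  Against two cops the territory
-- loses at most one vertex per round: if both cops stand inside it, the loss of their two vertices is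
-- offset by a vertex gained across an edge that leaves the territory from a cop-free vertex, and such
-- an edge exists because W_n minus two vertices is connected.  Starting from n - 2 vertices, the
-- territory survives n - 4 rounds.  Conversely, cops starting on the hub and on vertex 1 move to 2 and
-- n - 1; then one sweeps the rim down towards 3 while the other alternates between the hub and 2,
-- which captures every robber by round n - 3.

module Submission where

open import Defs
open import Data.Bool using (Bool; true; false)
import Data.Bool as Bool
open import Data.Empty using (⊥; ⊥-elim)
open import Data.Fin using (Fin; zero; suc; toℕ; fromℕ; fromℕ<; inject₁)
open import Data.Fin.Properties using (toℕ-injective; toℕ-fromℕ; toℕ-fromℕ<; toℕ-inject₁; toℕ<n; any?; all?)
import Data.Fin.Properties as Fin
open import Data.Fin.Subset using (Subset; _∈_; _∉_; _⊆_; _∪_; _-_; ⁅_⁆; ⊤; ∣_∣; Nonempty)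
import Data.Fin.Subset as Subset
open import Data.Fin.Subset.Properties
  using (_∈?_; p⊆q⇒∣p∣≤∣q∣; ∈⊤; x∈p∪q⁺; x∈p∪q⁻; x∈⁅x⁆; x∈⁅y⁆⇒x≡y; ∣⁅x⁆∣≡1; nonempty?; Empty-unique; ∣⊥∣≡0;
         x∈p∧x≢y⇒x∈p-y; x∈p⇒∣p-x∣<∣p∣; ∣⊤∣≡n)
open import Data.Maybe using (Maybe; just; nothing)
import Data.Maybe as Maybe
open import Data.Nat using (ℕ; zero; suc; _+_; _*_; _∸_; _^_; _≤_; _<_; NonZero; z≤n; s≤s; s≤s⁻¹; _<?_)
open import Data.Nat.DivMod using (_/_; _%_; _mod_; m*n/n≡m; m<n⇒m/n≡0; +-distrib-/-∣ʳ; [m+kn]%n≡m%n; m<n⇒m%n≡m)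
open import Data.Nat.Divisibility using (n∣m*n)
open import Data.Nat.Properties
open import Data.Product using (∃; ∃₂; _×_; _,_; proj₁)
open import Data.Sum using (_⊎_; inj₁; inj₂; map₁)
open import Data.Unit using (tt) renaming (⊤ to Unit)
open import Data.Vec using (_∷_; []; tabulate)
open import Data.Vec.Properties using (lookup∘tabulate; lookup⇒[]=; []=⇒lookup)
open import Function using (_∘_)
open import Level using (0ℓ)
open import Relation.Binary.PropositionalEquality
open import Relation.Nullary using (¬_; Dec; yes; no; does; contradiction)
open import Relation.Nullary.Decidable using (_×-dec_; _⊎-dec_; ¬?; dec-true; dec-false)
open import Relation.Unary using (Pred; Decidable)

private variable
  a b n k m : ℕ
  G : Graph

-- Capture and movement of robbers

Free : (G : Graph) → Cops G k → Fin (N G) → Set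
Free G c v = ∀ i → c i ≢ v

free? : (G : Graph) (c : Cops G k) (v : Fin (N G)) → Dec (Free G c v)
free? G c v = all? λ i → ¬? (c i Fin.≟ v)

capture-free : (G : Graph) (c : Cops G k) (r : Robbers G m) (j : Fin m) {v : Fin (N G)} →
               r j ≡ just v → Free G c v → capture G c r j ≡ just v
capture-free G c r j eq free with r j
capture-free G c r j refl free | just v with any? (λ i → c i Fin.≟ v)
... | yes (i , ci≡v) = ⊥-elim (free i ci≡v)
... | no _ = refl

capture-just⁻ : (G : Graph) (c : Cops G k) (r : Robbers G m) (j : Fin m) {v : Fin (N G)} →
                capture G c r j ≡ just v → r j ≡ just v × Free G c v
capture-just⁻ G c r j eq with r j
capture-just⁻ G c r j () | nothing
capture-just⁻ G c r j eq | just w with any? (λ i → c i Fin.≟ w)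
capture-just⁻ G c r j () | just w | yes _
capture-just⁻ G c r j refl | just w | no none = refl , λ i ci≡w → none (i , ci≡w)

Live : (G : Graph) → Pred (Fin (N G)) 0ℓ → Robbers G m → Set
Live G P r = ∀ j {v} → r j ≡ just v → P v

live-capture : {P Q : Pred (Fin (N G)) 0ℓ} (c : Cops G k) (r : Robbers G m) →
               Live G P r → (∀ {v} → P v → Free G c v → Q v) → Live G Q (capture G c r)
live-capture {G = G} c r live PQ j eq =
  let rj≡v , free = capture-just⁻ G c r j eq in PQ (live j rj≡v) free

robStep-just⁻ : {o : Maybe (Fin (N G))} {w : Fin (N G)} → RobStep G o (just w) →
                ∃ λ v → o ≡ just v × Move G v w
robStep-just⁻ (step mv) = _ , refl , mv

live-move : {P Q : Pred (Fin (N G)) 0ℓ} {r r' : Robbers G m} →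
            Live G P r → RobbersMove G r r' → (∀ {v w} → P v → Move G v w → Q w) → Live G Q r'
live-move {G} {r = r} live mv PQ j eq with robStep-just⁻ (subst (RobStep G (r j)) eq (mv j))
... | v , rj≡v , v→w = PQ (live j rj≡v) v→w

nobody-live : {r : Robbers G m} → Live G (λ _ → ⊥) r → AllCaptured G r
nobody-live {r = r} live j with r j in eq
... | nothing = refl
... | just v = ⊥-elim (live j eq)

-- Subsets and their sizes

subsetOf : {P : Pred (Fin n) 0ℓ} → Decidable P → Subset n
subsetOf P? = tabulate (does ∘ P?)

∈-subsetOf⁺ : {P : Pred (Fin n) 0ℓ} (P? : Decidable P) {x : Fin n} → P x → x ∈ subsetOf P?
∈-subsetOf⁺ P? {x} px = lookup⇒[]= x _ (trans (lookup∘tabulate _ x) (dec-true (P? x) px))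

∈-subsetOf⁻ : {P : Pred (Fin n) 0ℓ} (P? : Decidable P) {x : Fin n} → x ∈ subsetOf P? → P x
∈-subsetOf⁻ P? {x} x∈ with P? x | trans (sym (lookup∘tabulate _ x)) ([]=⇒lookup x∈)
... | yes px | _ = px
... | no _ | ()

∣p∪q∣≤∣p∣+∣q∣ : (p q : Subset n) → ∣ p ∪ q ∣ ≤ ∣ p ∣ + ∣ q ∣
∣p∪q∣≤∣p∣+∣q∣ [] [] = z≤n
∣p∪q∣≤∣p∣+∣q∣ (true ∷ p) (true ∷ q) = s≤s (≤-trans (∣p∪q∣≤∣p∣+∣q∣ p q) (+-monoʳ-≤ ∣ p ∣ (n≤1+n ∣ q ∣)))
∣p∪q∣≤∣p∣+∣q∣ (true ∷ p) (false ∷ q) = s≤s (∣p∪q∣≤∣p∣+∣q∣ p q)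
∣p∪q∣≤∣p∣+∣q∣ (false ∷ p) (true ∷ q) = ≤-trans (s≤s (∣p∪q∣≤∣p∣+∣q∣ p q)) (≤-reflexive (sym (+-suc ∣ p ∣ ∣ q ∣)))
∣p∪q∣≤∣p∣+∣q∣ (false ∷ p) (false ∷ q) = ∣p∪q∣≤∣p∣+∣q∣ p q

∣p∣≤suc∣q∣ : {p q : Subset n} (x : Fin n) → (∀ {u} → u ∈ p → x ≢ u → u ∈ q) → ∣ p ∣ ≤ suc ∣ q ∣
∣p∣≤suc∣q∣ {p = p} {q} x p∖x⊆q = begin
  ∣ p ∣             ≤⟨ p⊆q⇒∣p∣≤∣q∣ p⊆q∪x ⟩
  ∣ q ∪ ⁅ x ⁆ ∣     ≤⟨ ∣p∪q∣≤∣p∣+∣q∣ q ⁅ x ⁆ ⟩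
  ∣ q ∣ + ∣ ⁅ x ⁆ ∣ ≡⟨ cong (∣ q ∣ +_) (∣⁅x⁆∣≡1 x) ⟩
  ∣ q ∣ + 1         ≡⟨ +-comm ∣ q ∣ 1 ⟩
  suc ∣ q ∣         ∎
  where
  open ≤-Reasoning
  p⊆q∪x : p ⊆ q ∪ ⁅ x ⁆
  p⊆q∪x {u} u∈p with x Fin.≟ u
  ... | yes refl = x∈p∪q⁺ (inj₂ (x∈⁅x⁆ x))
  ... | no x≢u = x∈p∪q⁺ (inj₁ (p∖x⊆q u∈p x≢u))

∣p∣≤2+∣q∣ : {p q : Subset n} (x y : Fin n) → (∀ {u} → u ∈ p → x ≢ u → y ≢ u → u ∈ q) → ∣ p ∣ ≤ 2 + ∣ q ∣
∣p∣≤2+∣q∣ {p = p} {q} x y p∖xy⊆q = ≤-trans (∣p∣≤suc∣q∣ x p∖x⊆q∪y) (s≤s (∣p∣≤suc∣q∣ y q∪y∖y⊆q))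
  where
  p∖x⊆q∪y : ∀ {u} → u ∈ p → x ≢ u → u ∈ q ∪ ⁅ y ⁆
  p∖x⊆q∪y {u} u∈p x≢u with y Fin.≟ u
  ... | yes refl = x∈p∪q⁺ (inj₂ (x∈⁅x⁆ y))
  ... | no y≢u = x∈p∪q⁺ (inj₁ (p∖xy⊆q u∈p x≢u y≢u))
  q∪y∖y⊆q : ∀ {u} → u ∈ q ∪ ⁅ y ⁆ → y ≢ u → u ∈ q
  q∪y∖y⊆q u∈q∪y y≢u with x∈p∪q⁻ q ⁅ y ⁆ u∈q∪y
  ... | inj₁ u∈q = u∈q
  ... | inj₂ u∈⁅y⁆ = contradiction (sym (x∈⁅y⁆⇒x≡y y u∈⁅y⁆)) y≢u

∈∧∉⇒≢ : {S : Subset n} {u v : Fin n} → u ∈ S → v ∉ S → u ≢ v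
∈∧∉⇒≢ {S = S} u∈S v∉S u≡v = v∉S (subst (_∈ S) u≡v u∈S)

dec-true⁻ : {A : Set} (a? : Dec A) → does a? ≡ true → A
dec-true⁻ (yes a) _ = a

∣p∣>0⇒Nonempty : (p : Subset n) → 0 < ∣ p ∣ → Nonempty p
∣p∣>0⇒Nonempty {n} p 0<∣p∣ with nonempty? p
... | yes ne = ne
... | no empty = contradiction (trans (cong ∣_∣ (Empty-unique empty)) (∣⊥∣≡0 n)) (>⇒≢ 0<∣p∣)

module Escape (G : Graph) (move? : ∀ u v → Dec (Move G u v)) {{_ : NonZero (N G)}} where

  private
    V : ℕ
    V = N G

  Reach : Cops G k → Subset V → Pred (Fin V) 0ℓ
  Reach c S u = Free G c u × ∃ λ v → v ∈ S × Free G c v × Move G v u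

  reach? : (c : Cops G k) (S : Subset V) → Decidable (Reach c S)
  reach? c S u = free? G c u ×-dec any? λ v → (v ∈? S) ×-dec free? G c v ×-dec move? v u

  spread : Cops G k → Subset V → Subset V
  spread c S = subsetOf (reach? c S)

  ∈-spread⁺ : (c : Cops G k) {S : Subset V} {u v : Fin V} →
              Free G c u → v ∈ S → Free G c v → Move G v u → u ∈ spread c S
  ∈-spread⁺ c {S} u-free v∈S v-free v→u = ∈-subsetOf⁺ (reach? c S) (u-free , _ , v∈S , v-free , v→u)

  stay : (c : Cops G k) {S : Subset V} {u : Fin V} → Free G c u → u ∈ S → u ∈ spread c S
  stay c u-free u∈S = ∈-spread⁺ c u-free u∈S u-free (inj₁ refl)

  ∈-spread⁻ : (c : Cops G k) (S : Subset V) {u : Fin V} → u ∈ spread c S → Reach c S u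
  ∈-spread⁻ c S = ∈-subsetOf⁻ (reach? c S)

  cop∉spread : (c : Cops G k) (S : Subset V) (i : Fin k) → c i ∉ spread c S
  cop∉spread c S i cᵢ∈ = proj₁ (∈-spread⁻ c S cᵢ∈) i refl

  Escapes : ℕ → Cops G k → Subset V → Set
  Escapes zero c S = Nonempty S
  Escapes (suc t) c S = ∀ c' → CopsMove G c c' → Escapes t c' (spread c' S)

  dropDigits : ℕ → ℕ → ℕ
  dropDigits zero x = x
  dropDigits (suc t) x = dropDigits t x / V

  digit : ℕ → Fin m → Fin V
  digit t j = dropDigits t (toℕ j) mod V

  -- Robber j is identified with the base-V digits of j: those above the last t digits name its block,
  -- and the next digit is the vertex it heads for in the coming round.
  Blocks : ℕ → Robbers G m → Subset V → Set
  Blocks {m} t r S = ∀ {u} → u ∈ S →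
    ∃ λ p → suc p * V ^ t ≤ m × ∀ (j : Fin m) → dropDigits t (toℕ j) ≡ p → r j ≡ just u

  chase : Cops G k → Fin V → Fin V → Fin V
  chase c v u with move? v u ×-dec free? G c u
  ... | yes _ = u
  ... | no _ = v

  chase-move : (c : Cops G k) (v u : Fin V) → Move G v (chase c v u)
  chase-move c v u with move? v u ×-dec free? G c u
  ... | yes (v→u , _) = v→u
  ... | no _ = inj₁ refl

  chase-reaches : (c : Cops G k) {v u : Fin V} → Move G v u → Free G c u → chase c v u ≡ u
  chase-reaches c {v} {u} v→u u-free with move? v u ×-dec free? G c u
  ... | yes _ = refl
  ... | no fails = contradiction (v→u , u-free) fails

  flee : ℕ → Cops G k → Robbers G m → Robbers G m
  flee t c r j = Maybe.map (λ v → chase c v (digit t j)) (r j)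

  flee-moves : (t : ℕ) (c : Cops G k) (r : Robbers G m) → RobbersMove G r (flee t c r)
  flee-moves t c r j = map-step (r j)
    where
    map-step : (o : Maybe (Fin V)) → RobStep G o (Maybe.map (λ v → chase c v (digit t j)) o)
    map-step nothing = stays-captured
    map-step (just v) = step (chase-move c v (digit t j))

  mod-digit : (u : Fin V) (p : ℕ) → (toℕ u + p * V) mod V ≡ u
  mod-digit u p = toℕ-injective (begin
    toℕ ((toℕ u + p * V) mod V) ≡⟨ toℕ-fromℕ< _ ⟩
    (toℕ u + p * V) % V         ≡⟨ [m+kn]%n≡m%n (toℕ u) p V ⟩
    toℕ u % V                   ≡⟨ m<n⇒m%n≡m (toℕ<n u) ⟩
    toℕ u                       ∎)
    where open ≡-Reasoning

  div-digit : (u : Fin V) (p : ℕ) → (toℕ u + p * V) / V ≡ p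
  div-digit u p = begin
    (toℕ u + p * V) / V   ≡⟨ +-distrib-/-∣ʳ (toℕ u) (n∣m*n p) ⟩
    toℕ u / V + p * V / V ≡⟨ cong₂ _+_ (m<n⇒m/n≡0 (toℕ<n u)) (m*n/n≡m p V) ⟩
    p                     ∎
    where open ≡-Reasoning

  blocks-start : {c : Cops G k} (t : ℕ) → V ^ suc t ≤ m →
                 Blocks t (capture G c (λ j → just (digit t j))) (spread c ⊤)
  blocks-start {c = c} t bound {u} u∈ =
    toℕ u , ≤-trans (*-monoˡ-≤ (V ^ t) (toℕ<n u)) bound ,
    λ j eq → capture-free G c (λ j → just (digit t j)) j (cong just (trans (cong (_mod V) eq) toℕu-mod)) (proj₁ (∈-spread⁻ c ⊤ u∈))
    where
    toℕu-mod : toℕ u mod V ≡ u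
    toℕu-mod = trans (cong (_mod V) (sym (+-identityʳ (toℕ u)))) (mod-digit u 0)

  blocks-step : {c : Cops G k} {r : Robbers G m} {S : Subset V} (t : ℕ) → Blocks (suc t) r S →
                Blocks t (capture G c (flee t c (capture G c r))) (spread c S)
  blocks-step {m = m} {c = c} {r} {S} t blocks {u} u∈ with ∈-spread⁻ c S u∈
  ... | u-free , v , v∈S , v-free , v→u with blocks v∈S
  ...   | p , bound , occ = toℕ u + p * V , bound' , occ'
    where
    bound' : suc (toℕ u + p * V) * V ^ t ≤ m
    bound' = ≤-trans (*-monoˡ-≤ (V ^ t) (+-monoˡ-≤ (p * V) (toℕ<n u)))
                     (≤-trans (≤-reflexive (*-assoc (suc p) V (V ^ t))) bound)
    occ' : ∀ j → dropDigits t (toℕ j) ≡ toℕ u + p * V → capture G c (flee t c (capture G c r)) j ≡ just u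
    occ' j eq = capture-free G c (flee t c (capture G c r)) j moved u-free
      where
      open ≡-Reasoning
      at-v : r j ≡ just v
      at-v = occ j (trans (cong (_/ V) eq) (div-digit u p))
      moved : flee t c (capture G c r) j ≡ just u
      moved = begin
        flee t c (capture G c r) j   ≡⟨ cong (Maybe.map _) (capture-free G c r j at-v v-free) ⟩
        just (chase c v (digit t j)) ≡⟨ cong (just ∘ chase c v) (trans (cong (_mod V) eq) (mod-digit u p)) ⟩
        just (chase c v u)           ≡⟨ cong just (chase-reaches c v→u u-free) ⟩
        just u                       ∎

  survives : (t : ℕ) {c : Cops G k} {r : Robbers G m} {S : Subset V} →
             Blocks t r S → Escapes t c S → ¬ CopsWinIn G t c r
  survives {m = m} zero blocks (u , u∈S) captured with blocks u∈S
  ... | p , bound , occ with occ (fromℕ< p<m) (toℕ-fromℕ< p<m) | captured (fromℕ< p<m)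
    where
    p<m : p < m
    p<m = subst (_≤ m) (*-identityʳ (suc p)) bound
  ...   | caught | free = contradiction (trans (sym caught) free) λ ()
  survives (suc t) blocks escapes (c' , moves , win) =
    survives t (blocks-step t blocks) (escapes c' moves) (win _ (flee-moves t c' _))

  robbers-escape : (t : ℕ) → (∀ (c₀ : Cops G k) → Escapes t c₀ (spread c₀ ⊤)) → V ^ suc t ≤ m →
                   ¬ CaptWithin G k m t
  robbers-escape t escapes bound (c₀ , win) = survives t (blocks-start t bound) (escapes c₀) (win (digit t))

bool-crossing : (f : ℕ → Bool) → a ≤ b → f a ≢ f b → ∃ λ i → a ≤ i × i < b × f i ≢ f (suc i)
bool-crossing {b = zero} f z≤n fa≢fb = contradiction refl fa≢fb
bool-crossing {a} {suc b} f a≤1+b fa≢fb with m≤n⇒m<n∨m≡n a≤1+b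
... | inj₂ refl = contradiction refl fa≢fb
... | inj₁ a<1+b with f b Bool.≟ f (suc b)
...   | no fb≢f1+b = b , s≤s⁻¹ a<1+b , ≤-refl , fb≢f1+b
...   | yes fb≡f1+b with bool-crossing f (s≤s⁻¹ a<1+b) (λ fa≡fb → fa≢fb (trans fa≡fb fb≡f1+b))
...     | i , a≤i , i<b , fi≢f1+i = i , a≤i , m≤n⇒m≤1+n i<b , fi≢f1+i

-- Wheel geometry on vertex labels

wheelAdj? : ∀ n a b → Dec (WheelAdj n a b)
wheelAdj? n a b =
  ((a ≟ 0) ×-dec ¬? (b ≟ 0)) ⊎-dec ((b ≟ 0) ×-dec ¬? (a ≟ 0)) ⊎-dec
  ((1 ≤? a) ×-dec (suc a ≟ b)) ⊎-dec ((1 ≤? b) ×-dec (suc b ≟ a)) ⊎-dec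
  ((a ≟ 1) ×-dec (b ≟ n ∸ 1)) ⊎-dec ((b ≟ 1) ×-dec (a ≟ n ∸ 1))

pattern from-hub p  = inj₁ p
pattern to-hub p    = inj₂ (inj₁ p)
pattern rim-up p    = inj₂ (inj₂ (inj₁ p))
pattern rim-down p  = inj₂ (inj₂ (inj₂ (inj₁ p)))
pattern wrap-down p = inj₂ (inj₂ (inj₂ (inj₂ (inj₁ p))))
pattern wrap-up p   = inj₂ (inj₂ (inj₂ (inj₂ (inj₂ p))))

wheelAdj-sym : WheelAdj n a b → WheelAdj n b a
wheelAdj-sym (from-hub p)  = to-hub p
wheelAdj-sym (to-hub p)    = from-hub p
wheelAdj-sym (rim-up p)    = rim-down p
wheelAdj-sym (rim-down p)  = rim-up p
wheelAdj-sym (wrap-down p) = wrap-up p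
wheelAdj-sym (wrap-up p)   = wrap-down p

-- The rim of W_(suc n) carries the labels 1 … n.
Rim∖ : ℕ → ℕ → ℕ → Set
Rim∖ n y a = 1 ≤ a × a ≤ n × a ≢ y

RimCrossing : ℕ → ℕ → (ℕ → Bool) → Set
RimCrossing n y f = ∃₂ λ a b → Rim∖ n y a × Rim∖ n y b × WheelAdj (suc n) a b × f a ≢ f b

segment-crossing : (f : ℕ → Bool) {y : ℕ} → 1 ≤ a → a ≤ b → b ≤ n →
                   (∀ {i} → a ≤ i → i ≤ b → i ≢ y) → f a ≢ f b → RimCrossing n y f
segment-crossing f 1≤a a≤b b≤n avoids fa≢fb with bool-crossing f a≤b fa≢fb
... | i , a≤i , i<b , fi≢f1+i =
  i , suc i ,
  (≤-trans 1≤a a≤i , ≤-trans (<⇒≤ i<b) b≤n , avoids a≤i (<⇒≤ i<b)) ,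
  (s≤s z≤n , ≤-trans i<b b≤n , avoids (m≤n⇒m≤1+n a≤i) i<b) ,
  rim-up (≤-trans 1≤a a≤i , refl) , fi≢f1+i

rim-crossing-≤ : (f : ℕ → Bool) {y : ℕ} → Rim∖ n y a → Rim∖ n y b → a ≤ b → f a ≢ f b → RimCrossing n y f
rim-crossing-≤ {n} {a} {b} f {y} (1≤a , a≤n , a≢y) (1≤b , b≤n , b≢y) a≤b fa≢fb with a <? y | y <? b
... | yes a<y | yes y<b = around
  where
  around : RimCrossing n y f
  around with f b Bool.≟ f n
  ... | no fb≢fn = segment-crossing f 1≤b b≤n ≤-refl (λ b≤i _ i≡y → <⇒≱ y<b (subst (b ≤_) i≡y b≤i)) fb≢fn
  ... | yes fb≡fn with f n Bool.≟ f 1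
  ...   | no fn≢f1 = n , 1 , (≤-trans 1≤b b≤n , ≤-refl , λ n≡y → <⇒≱ y<b (subst (b ≤_) n≡y b≤n)) ,
                     (≤-refl , ≤-trans 1≤b b≤n , λ 1≡y → <⇒≱ a<y (subst (_≤ a) 1≡y 1≤a)) ,
                     wrap-up (refl , refl) , fn≢f1
  ...   | yes fn≡f1 = segment-crossing f ≤-refl 1≤a a≤n (λ _ i≤a i≡y → <⇒≱ a<y (subst (_≤ a) i≡y i≤a))
                        (λ f1≡fa → fa≢fb (sym (trans fb≡fn (trans fn≡f1 f1≡fa))))
... | no a≮y | _ = segment-crossing f 1≤a a≤b b≤n
                     (λ a≤i _ i≡y → a≮y (≤∧≢⇒< (subst (a ≤_) i≡y a≤i) a≢y)) fa≢fb
... | yes _ | no y≮b = segment-crossing f 1≤a a≤b b≤n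
                         (λ _ i≤b i≡y → y≮b (≤∧≢⇒< (subst (_≤ b) i≡y i≤b) (b≢y ∘ sym))) fa≢fb

rim-crossing : (f : ℕ → Bool) {y : ℕ} → Rim∖ n y a → Rim∖ n y b → f a ≢ f b → RimCrossing n y f
rim-crossing {a = a} {b} f ra rb fa≢fb with ≤-total a b
... | inj₁ a≤b = rim-crossing-≤ f ra rb a≤b fa≢fb
... | inj₂ b≤a = rim-crossing-≤ f rb ra b≤a (fa≢fb ∘ sym)

interior-move : 3 ≤ a → suc a < n → a ≡ b ⊎ WheelAdj n a b → b ≡ 0 ⊎ b ≡ 2 ⊎ (3 ≤ b × b ≤ suc a)
interior-move 3≤a _ (inj₁ refl) = inj₂ (inj₂ (3≤a , n≤1+n _))
interior-move () _ (inj₂ (from-hub (refl , _)))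
interior-move _ _ (inj₂ (to-hub (refl , _))) = inj₁ refl
interior-move 3≤a _ (inj₂ (rim-up (_ , refl))) = inj₂ (inj₂ (m≤n⇒m≤1+n 3≤a , ≤-refl))
interior-move (s≤s 2≤b) _ (inj₂ (rim-down (_ , refl))) with m≤n⇒m<n∨m≡n 2≤b
... | inj₁ 3≤b = inj₂ (inj₂ (3≤b , m≤n⇒m≤1+n (n≤1+n _)))
... | inj₂ refl = inj₂ (inj₁ refl)
interior-move (s≤s ()) _ (inj₂ (wrap-down (refl , _)))
interior-move {n = n} _ 1+a<n (inj₂ (wrap-up (_ , a≡n∸1))) =
  contradiction (subst (λ x → n ≤ suc x) (sym a≡n∸1) (m≤n+m∸n n 1)) (<⇒≱ 1+a<n)

module Wheel (k : ℕ) where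

  order : ℕ
  order = 4 + k

  W : Graph
  W = wheel order

  move? : ∀ u v → Dec (Move W u v)
  move? u v = (u Fin.≟ v) ⊎-dec wheelAdj? order (toℕ u) (toℕ v)

  open Escape W move?

  hub one two last : Fin order
  hub = zero
  one = suc zero
  two = suc (suc zero)
  last = fromℕ (3 + k)

  hub-move : {v : Fin order} → v ≢ hub → Move W hub v
  hub-move v≢hub = inj₂ (from-hub (refl , v≢hub ∘ toℕ-injective))

  to-hub-move : {v : Fin order} → v ≢ hub → Move W v hub
  to-hub-move v≢hub = inj₂ (to-hub (refl , v≢hub ∘ toℕ-injective))

  1≤toℕ : {v : Fin order} → v ≢ hub → 1 ≤ toℕ v
  1≤toℕ {zero} v≢hub = contradiction refl v≢hub
  1≤toℕ {suc _} _ = s≤s z≤n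

  free₁ : {c : Cops W 1} {v : Fin order} → c zero ≢ v → Free W c v
  free₁ c₀≢v zero = c₀≢v

  free₂ : {c : Cops W 2} {v : Fin order} → c zero ≢ v → c (suc zero) ≢ v → Free W c v
  free₂ c₀≢v c₁≢v zero = c₀≢v
  free₂ c₀≢v c₁≢v (suc zero) = c₁≢v

  another-neighbour : (u x : Fin order) → ∃ λ v → u ≢ v × x ≢ v × Move W v u
  another-neighbour zero x with x Fin.≟ one
  ... | yes refl = two , (λ ()) , (λ ()) , to-hub-move (λ ())
  ... | no x≢one = one , (λ ()) , x≢one , to-hub-move (λ ())
  another-neighbour (suc u) x with x Fin.≟ hub
  ... | no x≢hub = hub , (λ ()) , x≢hub , hub-move (λ ())
  another-neighbour (suc zero) _ | yes refl =
    last , (λ ()) , (λ ()) , inj₂ (wrap-up (refl , toℕ-fromℕ (3 + k)))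
  another-neighbour (suc (suc u)) _ | yes refl =
    suc (inject₁ u) , u≢v , (λ ()) , inj₂ (rim-up (s≤s z≤n , cong (2 +_) (toℕ-inject₁ u)))
    where
    u≢v : suc (suc u) ≢ suc (inject₁ u)
    u≢v u≡v = 1+n≢n (trans (suc-injective (cong toℕ u≡v)) (toℕ-inject₁ u))

  one-cop-escapes : ∀ t (c : Cops W 1) (S : Subset order) → (∀ {u} → c zero ≢ u → u ∈ S) → Escapes t c S
  one-cop-escapes zero c S covers with c zero Fin.≟ hub
  ... | yes c₀≡hub = one , covers λ c₀≡one → contradiction (trans (sym c₀≡hub) c₀≡one) λ ()
  ... | no c₀≢hub = hub , covers c₀≢hub
  one-cop-escapes (suc t) c S covers c' _ = one-cop-escapes t c' (spread c' S) covers'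
    where
    covers' : ∀ {u} → c' zero ≢ u → u ∈ spread c' S
    covers' {u} c'₀≢u with c zero Fin.≟ u
    ... | no c₀≢u = stay c' (free₁ c'₀≢u) (covers c₀≢u)
    ... | yes refl with another-neighbour u (c' zero)
    ...   | v , u≢v , c'₀≢v , v→u = ∈-spread⁺ c' (free₁ c'₀≢u) (covers u≢v) (free₁ c'₀≢v) v→u

  one-cop-not-strong : ¬ StrongKCopWin W 1
  one-cop-not-strong (L , M , capt) =
    robbers-escape L (λ c₀ → one-cop-escapes L c₀ (spread c₀ ⊤) (λ c₀≢u → stay c₀ (free₁ c₀≢u) ∈⊤))
      (m≤n+m (order ^ suc L) M) (proj₁ (capt (M + order ^ suc L) (m≤m+n M _)))

  Exit : Subset order → Fin order → Fin order → Set
  Exit S x y = ∃₂ λ v z → v ∈ S × x ≢ v × y ≢ v × z ∉ S × Move W v z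

  exit-swap : {S : Subset order} {x y : Fin order} → Exit S x y → Exit S y x
  exit-swap (v , z , v∈S , x≢v , y≢v , z∉S , v→z) = v , z , v∈S , y≢v , x≢v , z∉S , v→z

  label? : (S : Subset order) (a : ℕ) → Dec (∃ λ u → toℕ u ≡ a × u ∈ S)
  label? S a = any? λ u → (toℕ u ≟ a) ×-dec (u ∈? S)

  labelIn : Subset order → ℕ → Bool
  labelIn S a = does (label? S a)

  labelIn-∈ : {S : Subset order} {u : Fin order} → u ∈ S → labelIn S (toℕ u) ≡ true
  labelIn-∈ {S} {u} u∈S = dec-true (label? S (toℕ u)) (_ , refl , u∈S)

  labelIn-∉ : {S : Subset order} {u : Fin order} → u ∉ S → labelIn S (toℕ u) ≡ false
  labelIn-∉ {S} {u} u∉S = dec-false (label? S (toℕ u)) λ (w , w≡u , w∈S) → u∉S (subst (_∈ S) (toℕ-injective w≡u) w∈S)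

  rim∖ : {u y : Fin order} → u ≢ hub → y ≢ u → Rim∖ (3 + k) (toℕ y) (toℕ u)
  rim∖ {u} u≢hub y≢u = 1≤toℕ u≢hub , s≤s⁻¹ (toℕ<n u) , λ u≡y → y≢u (toℕ-injective (sym u≡y))

  exit-along : {S : Subset order} {y : Fin order} → Rim∖ (3 + k) (toℕ y) a → Rim∖ (3 + k) (toℕ y) b →
               WheelAdj order a b → labelIn S a ≡ true → labelIn S b ≡ false → Exit S hub y
  exit-along {a = a} {b} {S} (1≤a , _ , a≢y) (_ , b≤3+k , _) adj in-a out-b
    with dec-true⁻ (label? S a) in-a
  ... | v , refl , v∈S =
    v , z , v∈S , (λ hub≡v → contradiction (subst ((1 ≤_) ∘ toℕ) (sym hub≡v) 1≤a) λ ()) ,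
    (λ y≡v → a≢y (cong toℕ (sym y≡v))) , z∉S , inj₂ (subst (WheelAdj order (toℕ v)) (sym toℕz≡b) adj)
    where
    z : Fin order
    z = fromℕ< (s≤s b≤3+k)
    toℕz≡b : toℕ z ≡ b
    toℕz≡b = toℕ-fromℕ< (s≤s b≤3+k)
    z∉S : z ∉ S
    z∉S z∈S = contradiction (trans (sym (labelIn-∈ z∈S)) (subst (λ x → labelIn S x ≡ false) (sym toℕz≡b) out-b)) λ ()

  rim-exit : (S : Subset order) {y s d : Fin order} → s ∈ S → d ∉ S → s ≢ hub → d ≢ hub → y ≢ s → y ≢ d →
             Exit S hub y
  rim-exit S s∈S d∉S s≢hub d≢hub y≢s y≢d
    with rim-crossing (labelIn S) (rim∖ s≢hub y≢s) (rim∖ d≢hub y≢d)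
           (λ same → contradiction (trans (sym (labelIn-∈ s∈S)) (trans same (labelIn-∉ d∉S))) λ ())
  ... | a , b , ra , rb , adj , fa≢fb with labelIn S a in in-a | labelIn S b in in-b
  ...   | true  | false = exit-along ra rb adj in-a in-b
  ...   | false | true  = exit-along rb ra (wheelAdj-sym {order} adj) in-b in-a
  ...   | true  | true  = contradiction refl fa≢fb
  ...   | false | false = contradiction refl fa≢fb

  exit : (S : Subset order) {x y s d : Fin order} → x ∈ S → y ∈ S → s ∈ S → x ≢ s → y ≢ s → d ∉ S → Exit S x y
  exit S {x} {y} {s} {d} x∈S y∈S s∈S x≢s y≢s d∉S with hub ∈? S
  ... | no hub∉S = s , hub , s∈S , x≢s , y≢s , hub∉S , to-hub-move (∈∧∉⇒≢ s∈S hub∉S)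
  ... | yes hub∈S with x Fin.≟ hub | y Fin.≟ hub
  ...   | yes refl | _ = rim-exit S s∈S d∉S (x≢s ∘ sym) (∈∧∉⇒≢ hub∈S d∉S ∘ sym) y≢s (∈∧∉⇒≢ y∈S d∉S)
  ...   | no _ | yes refl = exit-swap (rim-exit S s∈S d∉S (y≢s ∘ sym) (∈∧∉⇒≢ hub∈S d∉S ∘ sym) x≢s (∈∧∉⇒≢ x∈S d∉S))
  ...   | no x≢hub | no y≢hub = hub , d , hub∈S , x≢hub , y≢hub , d∉S , hub-move (∈∧∉⇒≢ hub∈S d∉S ∘ sym)

  ∣S∣≤suc∣spread∣ : (c : Cops W 2) (S : Subset order) {s d : Fin order} → s ∈ S → Free W c s → d ∉ S →
                    ∣ S ∣ ≤ suc ∣ spread c S ∣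
  ∣S∣≤suc∣spread∣ c S s∈S s-free d∉S with c zero ∈? S | c (suc zero) ∈? S
  ... | no c₀∉S | _ = ∣p∣≤suc∣q∣ (c (suc zero)) λ u∈S c₁≢u → stay c (free₂ (∈∧∉⇒≢ u∈S c₀∉S ∘ sym) c₁≢u) u∈S
  ... | yes _ | no c₁∉S = ∣p∣≤suc∣q∣ (c zero) λ u∈S c₀≢u → stay c (free₂ c₀≢u (∈∧∉⇒≢ u∈S c₁∉S ∘ sym)) u∈S
  ... | yes c₀∈S | yes c₁∈S with exit S c₀∈S c₁∈S s∈S (s-free zero) (s-free (suc zero)) d∉S
  ...   | v , z , v∈S , c₀≢v , c₁≢v , z∉S , v→z = begin
    ∣ S ∣                   ≤⟨ ∣p∣≤2+∣q∣ (c zero) (c (suc zero)) S∖c⊆T-z ⟩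
    2 + ∣ spread c S - z ∣  ≤⟨ s≤s (x∈p⇒∣p-x∣<∣p∣ z∈T) ⟩
    suc ∣ spread c S ∣      ∎
    where
    open ≤-Reasoning
    z∈T : z ∈ spread c S
    z∈T = ∈-spread⁺ c (free₂ (∈∧∉⇒≢ c₀∈S z∉S) (∈∧∉⇒≢ c₁∈S z∉S)) v∈S (free₂ c₀≢v c₁≢v) v→z
    S∖c⊆T-z : ∀ {u} → u ∈ S → c zero ≢ u → c (suc zero) ≢ u → u ∈ spread c S - z
    S∖c⊆T-z u∈S c₀≢u c₁≢u = x∈p∧x≢y⇒x∈p-y (stay c (free₂ c₀≢u c₁≢u) u∈S) (∈∧∉⇒≢ u∈S z∉S)

  free-member : (c : Cops W 2) (S : Subset order) → 3 ≤ ∣ S ∣ → ∃ λ s → s ∈ S × Free W c s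
  free-member c S 3≤∣S∣ with any? (λ s → (s ∈? S) ×-dec free? W c s)
  ... | yes found = found
  ... | no none = contradiction (≤-trans (∣p∣≤2+∣q∣ {q = Subset.⊥} (c zero) (c (suc zero)) S⊆c)
                                         (≤-reflexive (cong (2 +_) (∣⊥∣≡0 order))))
                                (<⇒≱ 3≤∣S∣)
    where
    S⊆c : ∀ {u} → u ∈ S → c zero ≢ u → c (suc zero) ≢ u → u ∈ Subset.⊥
    S⊆c u∈S c₀≢u c₁≢u = contradiction (_ , u∈S , free₂ c₀≢u c₁≢u) none

  two-cops-escape : ∀ t (c : Cops W 2) (S : Subset order) → (∃ λ d → d ∉ S) → 2 + t ≤ ∣ S ∣ → Escapes t c S
  two-cops-escape zero c S _ 2≤∣S∣ = ∣p∣>0⇒Nonempty S (≤-trans (s≤s z≤n) 2≤∣S∣)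
  two-cops-escape (suc t) c S (d , d∉S) 3+t≤∣S∣ c' _ with free-member c' S (≤-trans (s≤s (s≤s (s≤s z≤n))) 3+t≤∣S∣)
  ... | s , s∈S , s-free =
    two-cops-escape t c' (spread c' S) (c' zero , cop∉spread c' S zero)
      (s≤s⁻¹ (≤-trans 3+t≤∣S∣ (∣S∣≤suc∣spread∣ c' S s∈S s-free d∉S)))

  data Shuttle : Fin order → Fin order → Set where
    hub→two : Shuttle hub two
    two→hub : Shuttle two hub

  shuttle-swap : {A A' : Fin order} → Shuttle A A' → Shuttle A' A
  shuttle-swap hub→two = two→hub
  shuttle-swap two→hub = hub→two

  shuttle-move : {A A' : Fin order} → Shuttle A A' → Move W A A'
  shuttle-move hub→two = hub-move (λ ())
  shuttle-move two→hub = to-hub-move (λ ())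

  shuttle-other : {A A' w : Fin order} → Shuttle A A' → A ≢ w → toℕ w ≡ 0 ⊎ toℕ w ≡ 2 → w ≡ A'
  shuttle-other hub→two hub≢w (inj₁ w≡0) = contradiction (sym (toℕ-injective {j = hub} w≡0)) hub≢w
  shuttle-other hub→two _ (inj₂ w≡2) = toℕ-injective w≡2
  shuttle-other two→hub _ (inj₁ w≡0) = toℕ-injective w≡0
  shuttle-other two→hub two≢w (inj₂ w≡2) = contradiction (sym (toℕ-injective {j = two} w≡2)) two≢w

  pair : Fin order → Fin order → Cops W 2
  pair A B zero = A
  pair A B (suc zero) = B

  pair-move : {A A' B B' : Fin order} → Move W A A' → Move W B B' → CopsMove W (pair A B) (pair A' B')
  pair-move A→A' _ zero = A→A'
  pair-move _ B→B' (suc zero) = B→B'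

  -- Apart from the sweeping cop's vertex 3 + t, the only exits from the arc 3 … 2 + t are the hub and 2,
  -- between which the other cop alternates.
  Between : ℕ → Fin order → Set
  Between t v = 3 ≤ toℕ v × toℕ v ≤ 2 + t

  below : {h : ℕ} {B v : Fin order} → toℕ v ≤ suc h → toℕ B ≡ suc h → B ≢ v → toℕ v ≤ h
  below v≤1+h B≡1+h B≢v = s≤s⁻¹ (≤∧≢⇒< v≤1+h λ v≡1+h → B≢v (toℕ-injective (trans B≡1+h (sym v≡1+h))))

  sweep-round : ∀ t {A A' B B' : Fin order} {R r' : Robbers W m} → Shuttle A A' →
                toℕ B ≡ 4 + t → toℕ B' ≡ 3 + t → Live W (Between (suc t)) R → RobbersMove W R r' →
                Live W (Between t) (capture W (pair A' B') (capture W (pair A B) r'))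
  sweep-round t {A} {A'} {B} {B'} {r' = r'} shuttle B≡4+t B'≡3+t unswept moves =
    live-capture (pair A' B') _ (live-capture (pair A B) r' (live-move unswept moves robber-step) after-robbers) after-cops
    where
    Reached : Fin order → Set
    Reached w = toℕ w ≡ 0 ⊎ toℕ w ≡ 2 ⊎ (3 ≤ toℕ w × toℕ w ≤ 4 + t)
    robber-step : ∀ {v w} → Between (suc t) v → Move W v w → Reached w
    robber-step {v} {w} (3≤v , v≤3+t) v→w
      with interior-move 3≤v (≤-<-trans (s≤s v≤3+t) (subst (_< order) B≡4+t (toℕ<n B)))
                         (map₁ (cong toℕ) v→w)
    ... | inj₁ w≡0 = inj₁ w≡0
    ... | inj₂ (inj₁ w≡2) = inj₂ (inj₁ w≡2)
    ... | inj₂ (inj₂ (3≤w , w≤1+v)) = inj₂ (inj₂ (3≤w , ≤-trans w≤1+v (s≤s v≤3+t)))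
    after-robbers : ∀ {w} → Reached w → Free W (pair A B) w → w ≡ A' ⊎ Between (suc t) w
    after-robbers (inj₁ w≡0) free = inj₁ (shuttle-other shuttle (free zero) (inj₁ w≡0))
    after-robbers (inj₂ (inj₁ w≡2)) free = inj₁ (shuttle-other shuttle (free zero) (inj₂ w≡2))
    after-robbers (inj₂ (inj₂ (3≤w , w≤4+t))) free = inj₂ (3≤w , below w≤4+t B≡4+t (free (suc zero)))
    after-cops : ∀ {w} → w ≡ A' ⊎ Between (suc t) w → Free W (pair A' B') w → Between t w
    after-cops (inj₁ refl) free = contradiction refl (free zero)
    after-cops (inj₂ (3≤w , w≤3+t)) free = 3≤w , below w≤3+t B'≡3+t (free (suc zero))

  sweep : ∀ t {A A' B : Fin order} → Shuttle A A' → toℕ B ≡ 3 + t → (R : Robbers W m) →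
          Live W (Between t) R → ∀ r' → RobbersMove W R r' → CopsWinIn W t (pair A B) (capture W (pair A B) r')
  sweep zero {A} {B = B} _ _ R unswept r' moves =
    nobody-live {G = W} (live-capture (pair A B) r' (live-move {Q = λ _ → ⊥} unswept moves λ (3≤v , v≤2) _ → <⇒≱ 3≤v v≤2) λ ())
  sweep (suc t) {A} {A'} {B} shuttle B≡4+t R unswept r' moves =
    pair A' B' , pair-move (shuttle-move shuttle) B→B' ,
    λ r'' moves' → sweep t (shuttle-swap shuttle) B'≡3+t _ (sweep-round t shuttle B≡4+t B'≡3+t unswept moves) r'' moves'
    where
    3+t<order : 3 + t < order
    3+t<order = <⇒≤ (subst (_< order) B≡4+t (toℕ<n B))
    B' : Fin order
    B' = fromℕ< 3+t<order
    B'≡3+t : toℕ B' ≡ 3 + t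
    B'≡3+t = toℕ-fromℕ< 3+t<order
    B→B' : Move W B B'
    B→B' = inj₂ (rim-down (subst (1 ≤_) (sym B'≡3+t) (s≤s z≤n) , trans (cong suc B'≡3+t) (sym B≡4+t)))

  3≤toℕ : {v : Fin order} → hub ≢ v → one ≢ v → two ≢ v → 3 ≤ toℕ v
  3≤toℕ {zero} hub≢v _ _ = contradiction refl hub≢v
  3≤toℕ {suc zero} _ one≢v _ = contradiction refl one≢v
  3≤toℕ {suc (suc zero)} _ _ two≢v = contradiction refl two≢v
  3≤toℕ {suc (suc (suc _))} _ _ _ = s≤s (s≤s (s≤s z≤n))

  opening : (r₀ : Fin m → Fin order) →
            Live W (Between k) (capture W (pair two last) (capture W (pair hub one) (just ∘ r₀)))
  opening r₀ = live-capture (pair two last) _ (live-capture {P = λ _ → Unit} (pair hub one) (just ∘ r₀) (λ _ _ → tt) λ _ free₀ → free₀)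
    λ {v} free₀ free₁ →
    3≤toℕ (free₀ zero) (free₀ (suc zero)) (free₁ zero) ,
    below (s≤s⁻¹ (toℕ<n v)) (toℕ-fromℕ (3 + k)) (free₁ (suc zero))

  capt-two-cops : ∀ m → CaptWithin W 2 m (suc k)
  capt-two-cops m = pair hub one , λ r₀ →
    pair two last , pair-move (hub-move (λ ())) (inj₂ (wrap-down (refl , toℕ-fromℕ (3 + k)))) ,
    sweep k two→hub (toℕ-fromℕ (3 + k)) _ (opening r₀)

  no-early-capture : ∀ t → t ≤ k → order ^ suc k ≤ m → ¬ CaptWithin W 2 m t
  no-early-capture t t≤k bound =
    robbers-escape t (λ c₀ → two-cops-escape t c₀ (spread c₀ ⊤) (c₀ zero , cop∉spread c₀ ⊤ zero) (size c₀))
      (≤-trans (^-monoʳ-≤ order (s≤s t≤k)) bound)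
    where
    size : ∀ c₀ → 2 + t ≤ ∣ spread c₀ ⊤ ∣
    size c₀ = +-cancelˡ-≤ 2 (2 + t) ∣ spread c₀ ⊤ ∣ (begin
      4 + t                  ≤⟨ +-monoʳ-≤ 4 t≤k ⟩
      order                  ≡⟨ sym (∣⊤∣≡n order) ⟩
      ∣ ⊤ {order} ∣          ≤⟨ ∣p∣≤2+∣q∣ {p = ⊤} (c₀ zero) (c₀ (suc zero)) (λ _ c₀≢u c₁≢u → stay c₀ (free₂ c₀≢u c₁≢u) ∈⊤) ⟩
      2 + ∣ spread c₀ ⊤ ∣    ∎)
      where open ≤-Reasoning

  capt-limit-two-cops : CaptLimit W 2 (suc k)
  capt-limit-two-cops = order ^ suc k , λ m bound →
    capt-two-cops m , λ t capt → ≮⇒≥ λ t<1+k → no-early-capture t (s≤s⁻¹ t<1+k) bound capt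

proposition4p9 : ∀ (n : ℕ) → 4 ≤ n →
    ¬ StrongKCopWin (wheel n) 1 × StrongKCopWin (wheel n) 2 × CaptLimit (wheel n) 2 (n ∸ 3)
proposition4p9 n 4≤n with k , refl ← m≤n⇒∃[o]m+o≡n 4≤n =
  one-cop-not-strong , (suc k , capt-limit-two-cops) , capt-limit-two-cops
  where open Wheel k
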